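{- Let $m,n$ be integers with $1<m<n$, $\gcd(m,n)=1$ and $mn\neq 6$. Then $\omega(M_{mn})>\omega(M_m)+\omega(M_n)$.
   Context: For an integer $n\ge 0$, $M_n=2^n-1$ denotes the $n$-th Mersenne number. For a positive integer $m$, $\omega(m)$ denotes the number of distinct prime divisors of $m$. -}

module Defs where

open import Data.Nat using (ℕ; _^_; _∸_)
open import Data.Nat.Divisibility using (_∣_; _∣?_)
open import Data.Nat.Primality using (Prime; prime?)
open import Data.List using (List; filter; length; upTo)
open import Data.Product using (_×_)
open import Relation.Nullary.Decidable using (_×-dec_)

M : ℕ → ℕ
M n = 2 ^ n ∸ 1

-- list of prime divisors of m (all prime divisors of m ≥ 1 lie in [0, m])
primeDivisors : ℕ → List ℕ
primeDivisors m = filter (λ p → prime? p ×-dec (p ∣? m)) (upTo (ℕ.suc m))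

-- ω(m): number of distinct prime divisors of m (meaningful for m ≥ 1)
ω : ℕ → ℕ
ω m = length (primeDivisors m)

{-# OPTIONS --safe #-}
module Submission where

open import Defs
open import Data.Nat using (ℕ; _<_; _*_; _+_)
open import Data.Nat.GCD using (gcd)
open import Relation.Binary.PropositionalEquality using (_≡_; _≢_)

open import Data.Nat using (zero; suc; _^_; _≤_; _≤′_; ≤′-refl; ≤′-step; z≤n; s≤s; s≤s⁻¹; NonZero; ≢-nonZero)
open import Data.Nat.Properties
open import Data.Nat.Divisibility
open import Data.Nat.Coprimality using (Coprime; coprime-divisor; coprime-Bézout; gcd≡1⇒coprime)
import Data.Nat.Coprimality as Coprime
open import Data.Nat.GCD using (module Bézout)
open import Data.Nat.ListAction using (product)
open import Data.Nat.ListAction.Properties using (∈⇒∣product)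
open import Data.Nat.Primality using (Prime; prime?; ¬prime[1])
open import Data.Nat.Primality.Factorisation using (factorise; PrimeFactorisation)
open import Data.Nat.Tactic.RingSolver using (solve-∀)
open import Data.List using (List; []; _∷_; [_]; _++_; _∷ʳ_; filter; length; upTo)
open import Data.List.Properties using (filter-++; length-++; upTo-∷ʳ)
open import Data.List.Relation.Unary.All as All using (All; []; _∷_; all?)
open import Data.List.Relation.Unary.All.Properties using (¬All⇒Any¬)
open import Data.List.Relation.Unary.Any using (here; there)
open import Data.List.Membership.Propositional using (_∈_; find)
open import Data.List.Membership.Propositional.Properties using (∈-upTo⁺)
open import Data.Product using (∃; ∃₂; _×_; _,_; proj₂)
open import Data.Sum using (_⊎_; inj₁; inj₂)
open import Data.Empty using (⊥; ⊥-elim)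
open import Function using (_∘_)
open import Relation.Nullary using (¬_; Dec; yes; no)
open import Relation.Nullary.Decidable using (_×-dec_; _⊎-dec_)
open import Relation.Unary using (Pred; Decidable)
open import Relation.Binary.PropositionalEquality using (refl; sym; trans; cong; cong₂; subst; module ≡-Reasoning)

-- Write a = M m, b = M n and N = M (m n). As a and b are coprime divisors of N, N = a b q where q
-- divides both N / a = Σ_{i<n} (1 + a)^i and N / b = Σ_{i<m} (1 + b)^i. Lifting the exponent
-- (a and b are odd) shows that a product of divisors of a dividing Σ_{i<n} (1 + a)^i divides n, and
-- likewise for b and m. So if every prime factor of q divided a or b, then q ∣ m n and N ≤ a b m n,
-- whereas a b m n < N once m n ≠ 6. Hence q has a prime factor dividing neither a nor b, and it is
-- counted by ω N on top of the (disjoint) prime factors of a and b.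

geomSum : ℕ → ℕ → ℕ
geomSum x zero    = 0
geomSum x (suc k) = 1 + x * geomSum x k

geomSum-nonZero : ∀ x k .{{_ : NonZero k}} → NonZero (geomSum x k)
geomSum-nonZero x (suc k) = _

suc^≡1+*geomSum : ∀ y k → suc y ^ k ≡ 1 + y * geomSum (suc y) k
suc^≡1+*geomSum y zero    = cong suc (sym (*-zeroʳ y))
suc^≡1+*geomSum y (suc k) =
  trans (cong (suc y *_) (suc^≡1+*geomSum y k)) (identity y (geomSum (suc y) k))
  where
  identity : ∀ y g → suc y * (1 + y * g) ≡ 1 + y * (1 + suc y * g)
  identity = solve-∀

geomSum-+ : ∀ x k l → geomSum x (k + l) ≡ geomSum x k + x ^ k * geomSum x l
geomSum-+ x zero    l = sym (*-identityˡ (geomSum x l))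
geomSum-+ x (suc k) l =
  trans (cong (λ s → 1 + x * s) (geomSum-+ x k l)) (identity x (geomSum x k) (x ^ k) (geomSum x l))
  where
  identity : ∀ x g c h → 1 + x * (g + c * h) ≡ 1 + x * g + x * c * h
  identity = solve-∀

geomSum-* : ∀ x k l → geomSum x (k * l) ≡ geomSum (x ^ k) l * geomSum x k
geomSum-* x k zero    = cong (geomSum x) (*-zeroʳ k)
geomSum-* x k (suc l) = begin
  geomSum x (k * suc l)                           ≡⟨ cong (geomSum x) (*-suc k l) ⟩
  geomSum x (k + k * l)                           ≡⟨ geomSum-+ x k (k * l) ⟩
  geomSum x k + x ^ k * geomSum x (k * l)
    ≡⟨ cong (λ s → geomSum x k + x ^ k * s) (geomSum-* x k l) ⟩
  geomSum x k + x ^ k * (geomSum (x ^ k) l * geomSum x k)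
    ≡⟨ identity (geomSum x k) (x ^ k) (geomSum (x ^ k) l) ⟩
  (1 + x ^ k * geomSum (x ^ k) l) * geomSum x k   ∎
  where
  open ≡-Reasoning
  identity : ∀ g c h → g + c * (h * g) ≡ (1 + c * h) * g
  identity = solve-∀

geomSum-≡-exponent-mod : ∀ y k → ∃ λ h → geomSum (suc y) k ≡ y * h + k
geomSum-≡-exponent-mod y zero    = 0 , sym (trans (+-identityʳ (y * 0)) (*-zeroʳ y))
geomSum-≡-exponent-mod y (suc k) =
  let h , eq = geomSum-≡-exponent-mod y k
  in k + h + y * h , trans (cong (λ s → 1 + suc y * s) eq) (identity y k h)
  where
  identity : ∀ y k h → 1 + suc y * (y * h + k) ≡ y * (k + h + y * h) + suc k
  identity = solve-∀

∣geomSum⇒∣exponent : ∀ {d y k} → d ∣ y → d ∣ geomSum (suc y) k → d ∣ k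
∣geomSum⇒∣exponent {d} {y} {k} d∣y d∣G =
  let h , eq = geomSum-≡-exponent-mod y k
  in ∣m+n∣m⇒∣n (subst (d ∣_) eq d∣G) (∣-trans d∣y (m∣m*n h))

-- The expansion Σ_{i<p} (1 + y)^i ≡ p + y p (p - 1) / 2 (mod y²) at odd p = 1 + 2 r.
geomSum-odd-exponent : ∀ y r → ∃ λ c → geomSum (suc y) (1 + 2 * r) ≡ (1 + 2 * r) * (1 + y * r) + y * y * c
geomSum-odd-exponent y zero    = 0 , base y
  where
  base : ∀ y → 1 + suc y * 0 ≡ 1 * (1 + y * 0) + y * y * 0
  base = solve-∀
geomSum-odd-exponent y (suc r) =
  let c , eq = geomSum-odd-exponent y r
  in c + 2 * (1 + 2 * r) * r + (1 + 2 * r) + y * (2 * c + (1 + 2 * r) * r) + y * y * c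
   , trans (cong (geomSum (suc y)) (two-more r))
           (trans (cong (λ s → 1 + suc y * (1 + suc y * s)) eq) (identity y r c))
  where
  two-more : ∀ r → 1 + 2 * suc r ≡ 2 + (1 + 2 * r)
  two-more = solve-∀
  identity : ∀ y r c →
    1 + suc y * (1 + suc y * ((1 + 2 * r) * (1 + y * r) + y * y * c)) ≡
    (1 + 2 * suc r) * (1 + y * suc r) +
      y * y * (c + 2 * (1 + 2 * r) * r + (1 + 2 * r) + y * (2 * c + (1 + 2 * r) * r) + y * y * c)
  identity = solve-∀

geomSum-odd-divisor : ∀ r y → 1 + 2 * r ∣ y → ∃ λ v → geomSum (suc y) (1 + 2 * r) ≡ (1 + 2 * r) * (1 + y * v)
geomSum-odd-divisor r .(t * (1 + 2 * r)) (divides-refl t) =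
  let c , eq = geomSum-odd-exponent (t * (1 + 2 * r)) r
  in r + t * c , trans eq (identity (1 + 2 * r) r t c)
  where
  identity : ∀ p r t c → p * (1 + t * p * r) + t * p * (t * p) * c ≡ p * (1 + t * p * (r + t * c))
  identity = solve-∀

geomSum-*-odd-divisor : ∀ r y k → 1 + 2 * r ∣ y →
  ∃ λ v → geomSum (suc y) (k * (1 + 2 * r)) ≡ (1 + 2 * r) * ((1 + y * v) * geomSum (suc y) k)
geomSum-*-odd-divisor r y k p∣y =
  let v , eq = geomSum-odd-divisor r (y * g) (∣m⇒∣m*n g p∣y)
  in g * v , (begin
    geomSum (suc y) (k * p)             ≡⟨ geomSum-* (suc y) k p ⟩
    geomSum (suc y ^ k) p * g           ≡⟨ cong (λ x → geomSum x p * g) (suc^≡1+*geomSum y k) ⟩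
    geomSum (suc (y * g)) p * g         ≡⟨ cong (_* g) eq ⟩
    p * (1 + y * g * v) * g             ≡⟨ identity p y g v ⟩
    p * ((1 + y * (g * v)) * g)         ∎)
  where
  open ≡-Reasoning
  p = 1 + 2 * r
  g = geomSum (suc y) k
  identity : ∀ p y g v → p * (1 + y * g * v) * g ≡ p * ((1 + y * (g * v)) * g)
  identity = solve-∀

¬2∣⇒≡1+2* : ∀ n → ¬ 2 ∣ n → ∃ λ r → n ≡ 1 + 2 * r
¬2∣⇒≡1+2* zero          2∤0 = ⊥-elim (2∤0 (2 ∣0))
¬2∣⇒≡1+2* (suc zero)    _   = 0 , refl
¬2∣⇒≡1+2* (suc (suc n)) 2∤n =
  let r , eq = ¬2∣⇒≡1+2* n (2∤n ∘ ∣m∣n⇒∣m+n ∣-refl)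
  in suc r , trans (cong (2 +_) eq) (identity r)
  where
  identity : ∀ r → 2 + (1 + 2 * r) ≡ 1 + 2 * suc r
  identity = solve-∀

∣⇒nonZero : ∀ {m n} .{{_ : NonZero n}} → m ∣ n → NonZero m
∣⇒nonZero (divides-refl q) = m*n≢0⇒n≢0 q

∣⇒coprime-1+* : ∀ {d y} v → d ∣ y → Coprime d (1 + y * v)
∣⇒coprime-1+* v d∣y (i∣d , i∣1+yv) = ∣1⇒≡1 (∣m+n∣n⇒∣m i∣1+yv (∣-trans i∣d (∣-trans d∣y (m∣m*n v))))
  where
  ∣m+n∣n⇒∣m : ∀ {i m n} → i ∣ m + n → i ∣ n → i ∣ m
  ∣m+n∣n⇒∣m {i} {m} {n} i∣m+n = ∣m+n∣m⇒∣n (subst (i ∣_) (+-comm m n) i∣m+n)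

coprime-product : ∀ {n ms} → All (λ m → Coprime m n) ms → Coprime (product ms) n
coprime-product []                   (i∣1 , _)      = ∣1⇒≡1 i∣1
coprime-product {n} {m ∷ ms} (m⊥n ∷ ms⊥n) {i} (i∣mM , i∣n) =
  coprime-product ms⊥n (coprime-divisor i⊥m i∣mM , i∣n)
  where
  i⊥m : Coprime i m
  i⊥m (j∣i , j∣m) = m⊥n (j∣m , ∣-trans j∣i i∣n)

product-partition : ∀ {ℓ} {P Q : Pred ℕ ℓ} {ds} → All (λ d → P d ⊎ Q d) ds →
  ∃₂ λ es fs → product ds ≡ product es * product fs × All P es × All Q fs
product-partition [] = [] , [] , refl , [] , []
product-partition {ds = d ∷ ds} (inj₁ Pd ∷ PQds) =
  let es , fs , eq , Pes , Qfs = product-partition PQds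
  in d ∷ es , fs , trans (cong (d *_) eq) (sym (*-assoc d (product es) (product fs))) , Pd ∷ Pes , Qfs
product-partition {ds = d ∷ ds} (inj₂ Qd ∷ PQds) =
  let es , fs , eq , Pes , Qfs = product-partition PQds
  in es , d ∷ fs , trans (cong (d *_) eq) (x*[y*z]≡y*[x*z] d (product es) (product fs)) , Pes , Qd ∷ Qfs
  where
  x*[y*z]≡y*[x*z] : ∀ x y z → x * (y * z) ≡ y * (x * z)
  x*[y*z]≡y*[x*z] = solve-∀

-- Writing n = k d, geomSum (1 + y) n = d u geomSum (1 + y) k with u ≡ 1 (mod y) coprime to the
-- remaining factors, so each factor d is peeled off n in turn.
product-∣geomSum⇒∣exponent : ∀ {y ds} → ¬ 2 ∣ y → All (_∣ y) ds →
  ∀ n → product ds ∣ geomSum (suc y) n → product ds ∣ n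
product-∣geomSum⇒∣exponent _ [] n _ = 1∣ n
product-∣geomSum⇒∣exponent {y} {d ∷ ds} 2∤y (d∣y ∷ ds∣y) n d∏ds∣G
  with ¬2∣⇒≡1+2* d (λ 2∣d → 2∤y (∣-trans 2∣d d∣y))
... | r , refl with ∣geomSum⇒∣exponent {k = n} d∣y (m*n∣⇒m∣ d (product ds) d∏ds∣G)
... | divides-refl k =
  let v , eq = geomSum-*-odd-divisor r y k d∣y
      ∏ds∣uG = *-cancelˡ-∣ d (subst (d * product ds ∣_) eq d∏ds∣G)
      ∏ds∣G = coprime-divisor (coprime-product (All.map (∣⇒coprime-1+* v) ds∣y)) ∏ds∣uG
  in subst (d * product ds ∣_) (*-comm d k) (*-monoʳ-∣ d (product-∣geomSum⇒∣exponent 2∤y ds∣y k ∏ds∣G))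

∣geomSum-∣geomSum⇒new-prime⊎∣* : ∀ {y z k l q} .{{_ : NonZero k}} → ¬ 2 ∣ y → ¬ 2 ∣ z →
  q ∣ geomSum (suc y) k → q ∣ geomSum (suc z) l →
  (∃ λ p → Prime p × p ∣ q × ¬ p ∣ y × ¬ p ∣ z) ⊎ q ∣ k * l
∣geomSum-∣geomSum⇒new-prime⊎∣* {y} {z} {k} {l} {q} 2∤y 2∤z q∣Gy q∣Gz =
  by-cases (all? (λ p → p ∣? y ⊎-dec p ∣? z) ps)
  where
  instance
    q≢0 : NonZero q
    q≢0 = ∣⇒nonZero {{geomSum-nonZero (suc y) k}} q∣Gy
  open PrimeFactorisation (factorise q)
    renaming (factors to ps; isFactorisation to q≡∏ps; factorsPrime to ps-prime)
  by-cases : Dec (All (λ p → p ∣ y ⊎ p ∣ z) ps) → (∃ λ p → Prime p × p ∣ q × ¬ p ∣ y × ¬ p ∣ z) ⊎ q ∣ k * l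
  by-cases (no ¬all) =
    let p , p∈ps , p∤y∨z = find (¬All⇒Any¬ (λ p → p ∣? y ⊎-dec p ∣? z) ps ¬all)
        p∣q = subst (p ∣_) (sym q≡∏ps) (∈⇒∣product p∈ps)
    in inj₁ (p , All.lookup ps-prime p∈ps , p∣q , p∤y∨z ∘ inj₁ , p∤y∨z ∘ inj₂)
  by-cases (yes all) =
    let es , fs , ∏ps≡∏es*∏fs , es∣y , fs∣z = product-partition all
        q≡∏es*∏fs = trans q≡∏ps ∏ps≡∏es*∏fs
        ∏es∣q = subst (product es ∣_) (sym q≡∏es*∏fs) (m∣m*n (product fs))
        ∏fs∣q = subst (product fs ∣_) (sym q≡∏es*∏fs) (n∣m*n (product es))
        ∏es∣k = product-∣geomSum⇒∣exponent 2∤y es∣y k (∣-trans ∏es∣q q∣Gy)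
        ∏fs∣l = product-∣geomSum⇒∣exponent 2∤z fs∣z l (∣-trans ∏fs∣q q∣Gz)
    in inj₂ (subst (_∣ k * l) (sym q≡∏es*∏fs) (*-pres-∣ ∏es∣k ∏fs∣l))

2^≡1+M : ∀ n → 2 ^ n ≡ 1 + M n
2^≡1+M n = sym (m+[n∸m]≡n (m^n>0 2 n))

M-suc : ∀ n → M (suc n) ≡ 1 + 2 * M n
M-suc n = suc-injective (begin
  1 + M (suc n)  ≡⟨ sym (2^≡1+M (suc n)) ⟩
  2 * 2 ^ n      ≡⟨ cong (2 *_) (2^≡1+M n) ⟩
  2 * (1 + M n)  ≡⟨ *-distribˡ-+ 2 1 (M n) ⟩
  2 + 2 * M n    ∎)
  where open ≡-Reasoning

M-* : ∀ m n → M (m * n) ≡ M m * geomSum (1 + M m) n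
M-* m n = suc-injective (begin
  1 + M (m * n)                  ≡⟨ sym (2^≡1+M (m * n)) ⟩
  2 ^ (m * n)                    ≡⟨ sym (^-*-assoc 2 m n) ⟩
  (2 ^ m) ^ n                    ≡⟨ cong (_^ n) (2^≡1+M m) ⟩
  (1 + M m) ^ n                  ≡⟨ suc^≡1+*geomSum (M m) n ⟩
  1 + M m * geomSum (1 + M m) n  ∎)
  where open ≡-Reasoning

M-nonZero : ∀ n .{{_ : NonZero n}} → NonZero (M n)
M-nonZero (suc n) = subst NonZero (sym (M-suc n)) _

M-odd : ∀ n .{{_ : NonZero n}} → ¬ 2 ∣ M n
M-odd (suc n) 2∣M = 2≢1 (∣1⇒≡1 (∣m+n∣m⇒∣n 2∣2M+1 (m∣m*n (M n))))
  where
  2∣2M+1 : 2 ∣ 2 * M n + 1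
  2∣2M+1 = subst (2 ∣_) (trans (M-suc n) (+-comm 1 (2 * M n))) 2∣M
  2≢1 : 2 ≢ 1
  2≢1 ()

M-mono-∣ : ∀ {m n} → m ∣ n → M m ∣ M n
M-mono-∣ {m} (divides-refl k) =
  divides (geomSum (1 + M m) k)
    (trans (cong M (*-comm k m)) (trans (M-* m k) (*-comm (M m) (geomSum (1 + M m) k))))

∣M∧∣M-suc⇒∣1 : ∀ {d} k → d ∣ M k → d ∣ M (suc k) → d ∣ 1
∣M∧∣M-suc⇒∣1 {d} k d∣M d∣M′ =
  ∣m+n∣m⇒∣n (subst (d ∣_) (trans (M-suc k) (+-comm 1 (2 * M k))) d∣M′) (∣n⇒∣m*n 2 d∣M)

gcd≡1⇒M-coprime : ∀ m n → gcd m n ≡ 1 → Coprime (M m) (M n)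
gcd≡1⇒M-coprime m n gcd≡1 {d} (d∣Mm , d∣Mn) = ∣1⇒≡1 (from-Bézout (coprime-Bézout (gcd≡1⇒coprime {m} gcd≡1)))
  where
  ∣M-* : ∀ {j} k → d ∣ M j → d ∣ M (k * j)
  ∣M-* k d∣Mj = ∣-trans d∣Mj (M-mono-∣ (n∣m*n k))
  from-Bézout : Bézout.Identity 1 m n → d ∣ 1
  from-Bézout (Bézout.+- x y eq) =
    ∣M∧∣M-suc⇒∣1 (y * n) (∣M-* y d∣Mn) (subst (λ j → d ∣ M j) (sym eq) (∣M-* x d∣Mm))
  from-Bézout (Bézout.-+ x y eq) =
    ∣M∧∣M-suc⇒∣1 (x * m) (∣M-* x d∣Mm) (subst (λ j → d ∣ M j) (sym eq) (∣M-* y d∣Mn))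

c*[1+n]≤2^[1+n]⇒c*[2+n]≤2^[2+n] : ∀ c n → c * suc n ≤ 2 ^ suc n → c * suc (suc n) ≤ 2 ^ suc (suc n)
c*[1+n]≤2^[1+n]⇒c*[2+n]≤2^[2+n] c n h = begin
  c * suc (suc n)        ≡⟨ *-suc c (suc n) ⟩
  c + c * suc n          ≤⟨ +-mono-≤ (≤-trans (m≤m*n c (suc n)) h) h ⟩
  2 ^ suc n + 2 ^ suc n  ≡⟨ cong (2 ^ suc n +_) (sym (+-identityʳ (2 ^ suc n))) ⟩
  2 ^ suc (suc n)        ∎
  where open ≤-Reasoning

2*n≤2^n : ∀ n → 2 * n ≤ 2 ^ n
2*n≤2^n zero          = z≤n
2*n≤2^n (suc zero)    = ≤-refl
2*n≤2^n (suc (suc n)) = c*[1+n]≤2^[1+n]⇒c*[2+n]≤2^[2+n] 2 n (2*n≤2^n (suc n))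

8*[6+n]≤2^[6+n] : ∀ n → 8 * (6 + n) ≤ 2 ^ (6 + n)
8*[6+n]≤2^[6+n] zero    = ≤ᵇ⇒≤ 48 64 _
8*[6+n]≤2^[6+n] (suc n) = c*[1+n]≤2^[1+n]⇒c*[2+n]≤2^[2+n] 8 (5 + n) (8*[6+n]≤2^[6+n] n)

2^2*2^n*[2*n]≤2^[2*n] : ∀ {n} → 6 ≤ n → 2 ^ 2 * 2 ^ n * (2 * n) ≤ 2 ^ (2 * n)
2^2*2^n*[2*n]≤2^[2*n] {n} (s≤s (s≤s (s≤s (s≤s (s≤s (s≤s {n = c} _)))))) = begin
  2 ^ 2 * 2 ^ n * (2 * n)  ≡⟨ identity (2 ^ n) n ⟩
  2 ^ n * (8 * n)          ≤⟨ *-monoʳ-≤ (2 ^ n) (8*[6+n]≤2^[6+n] c) ⟩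
  2 ^ n * 2 ^ n            ≡⟨ sym (^-distribˡ-+-* 2 n n) ⟩
  2 ^ (n + n)              ≡⟨ cong (2 ^_) (sym (cong (n +_) (+-identityʳ n))) ⟩
  2 ^ (2 * n)              ∎
  where
  open ≤-Reasoning
  identity : ∀ x n → 2 ^ 2 * x * (2 * n) ≡ x * (8 * n)
  identity = solve-∀

2^m*2^n*[m*n]≤2^[m*n] : ∀ {m n} → 3 ≤ m → 4 ≤ n → 2 ^ m * 2 ^ n * (m * n) ≤ 2 ^ (m * n)
2^m*2^n*[m*n]≤2^[m*n] {m} {n} (s≤s (s≤s (s≤s {n = a} _))) (s≤s (s≤s (s≤s (s≤s {n = b} _)))) =
  *-cancelˡ-≤ 4 (begin
    4 * (2 ^ m * 2 ^ n * (m * n))      ≡⟨ reorder (2 ^ m) (2 ^ n) m n ⟩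
    (2 * m) * (2 * n) * (2 ^ m * 2 ^ n) ≤⟨ *-monoˡ-≤ (2 ^ m * 2 ^ n) (*-mono-≤ (2*n≤2^n m) (2*n≤2^n n)) ⟩
    (2 ^ m * 2 ^ n) * (2 ^ m * 2 ^ n)  ≡⟨ sym (cong₂ _*_ (^-distribˡ-+-* 2 m n) (^-distribˡ-+-* 2 m n)) ⟩
    2 ^ (m + n) * 2 ^ (m + n)          ≡⟨ sym (^-distribˡ-+-* 2 (m + n) (m + n)) ⟩
    2 ^ (m + n + (m + n))              ≤⟨ ^-monoʳ-≤ 2 m+n+[m+n]≤2+m*n ⟩
    2 ^ (2 + m * n)                    ≡⟨ ^-distribˡ-+-* 2 2 (m * n) ⟩
    4 * 2 ^ (m * n)                    ∎)
  where
  open ≤-Reasoning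
  reorder : ∀ x y m n → 4 * (x * y * (m * n)) ≡ (2 * m) * (2 * n) * (x * y)
  reorder = solve-∀
  exponents : ∀ a b → (3 + a + (4 + b) + (3 + a + (4 + b))) + (2 * a + b + a * b) ≡ 2 + (3 + a) * (4 + b)
  exponents = solve-∀
  -- that is, (m - 2) (n - 2) ≥ 2
  m+n+[m+n]≤2+m*n : m + n + (m + n) ≤ 2 + m * n
  m+n+[m+n]≤2+m*n = ≤-trans (m≤m+n (m + n + (m + n)) (2 * a + b + a * b)) (≤-reflexive (exponents a b))

M*M*s<M[m*n] : ∀ m n s → 2 ≤ s → 2 ^ m * 2 ^ n * s ≤ 2 ^ (m * n) → M m * M n * s < M (m * n)
M*M*s<M[m*n] m n s 2≤s h = s≤s⁻¹ (begin
  2 + M m * M n * s                    ≤⟨ +-monoˡ-≤ (M m * M n * s) 2≤s ⟩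
  s + M m * M n * s                    ≤⟨ m≤m+n _ _ ⟩
  s + M m * M n * s + (M m + M n) * s  ≡⟨ expand (M m) (M n) s ⟩
  (1 + M m) * (1 + M n) * s            ≡⟨ sym (cong₂ (λ x y → x * y * s) (2^≡1+M m) (2^≡1+M n)) ⟩
  2 ^ m * 2 ^ n * s                    ≤⟨ h ⟩
  2 ^ (m * n)                          ≡⟨ 2^≡1+M (m * n) ⟩
  1 + M (m * n)                        ∎)
  where
  open ≤-Reasoning
  expand : ∀ a b s → s + a * b * s + (a + b) * s ≡ (1 + a) * (1 + b) * s
  expand = solve-∀

M*M*[m*n]<M[m*n] : ∀ {m n} → 1 < m → m < n → gcd m n ≡ 1 → m * n ≢ 6 → M m * M n * (m * n) < M (m * n)
M*M*[m*n]<M[m*n] {0} ()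
M*M*[m*n]<M[m*n] {1} (s≤s ())
M*M*[m*n]<M[m*n] {2} {0} _ ()
M*M*[m*n]<M[m*n] {2} {1} _ (s≤s ())
M*M*[m*n]<M[m*n] {2} {2} _ (s≤s (s≤s ()))
M*M*[m*n]<M[m*n] {2} {3} _ _ _ 2*3≢6 = ⊥-elim (2*3≢6 refl)
M*M*[m*n]<M[m*n] {2} {4} _ _ () _
M*M*[m*n]<M[m*n] {2} {5} _ _ _ _ = ≤ᵇ⇒≤ 931 1023 _   -- the one pair below both exponential bounds
M*M*[m*n]<M[m*n] {2} {suc (suc (suc (suc (suc (suc c)))))} _ _ _ _ =
  M*M*s<M[m*n] 2 (6 + c) (2 * (6 + c)) (m≤m+n 2 _) (2^2*2^n*[2*n]≤2^[2*n] (m≤m+n 6 c))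
M*M*[m*n]<M[m*n] {suc (suc (suc a))} {n} _ 3+a<n _ _ =
  M*M*s<M[m*n] m n (m * n) (≤-trans (m≤m+n 2 (1 + a)) (m≤m*n m n {{≢-nonZero (m<n⇒n≢0 3+a<n)}}))
    (2^m*2^n*[m*n]≤2^[m*n] (m≤m+n 3 a) (≤-trans (m≤m+n 4 a) 3+a<n))
  where m = 3 + a

coprime-cofactor : ∀ {a b A B} .{{_ : NonZero b}} → Coprime a b → a * A ≡ b * B →
  ∃ λ q → A ≡ b * q × B ≡ a * q
coprime-cofactor {a} {b} {B = B} a⊥b aA≡bB
  with coprime-divisor (Coprime.sym a⊥b) (divides B (trans aA≡bB (*-comm b B)))
... | divides-refl q = q , *-comm q b , *-cancelˡ-≡ B (a * q) b (begin
  b * B        ≡⟨ sym aA≡bB ⟩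
  a * (q * b)  ≡⟨ x*[y*z]≡z*[x*y] a q b ⟩
  b * (a * q)  ∎)
  where
  open ≡-Reasoning
  x*[y*z]≡z*[x*y] : ∀ x y z → x * (y * z) ≡ z * (x * y)
  x*[y*z]≡z*[x*y] = solve-∀

M-*-cofactor : ∀ m n .{{_ : NonZero n}} → gcd m n ≡ 1 →
  ∃ λ q → M (m * n) ≡ M m * M n * q × q ∣ geomSum (1 + M m) n × q ∣ geomSum (1 + M n) m
M-*-cofactor m n gcd≡1
  with coprime-cofactor {{M-nonZero n}} (gcd≡1⇒M-coprime m n gcd≡1) aA≡bB
  where
  aA≡bB : M m * geomSum (1 + M m) n ≡ M n * geomSum (1 + M n) m
  aA≡bB = trans (sym (M-* m n)) (trans (cong M (*-comm m n)) (M-* n m))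
... | q , A≡bq , B≡aq = q , N≡abq , divides (M n) A≡bq , divides (M m) B≡aq
  where
  open ≡-Reasoning
  N≡abq : M (m * n) ≡ M m * M n * q
  N≡abq = begin
    M (m * n)                  ≡⟨ M-* m n ⟩
    M m * geomSum (1 + M m) n  ≡⟨ cong (M m *_) A≡bq ⟩
    M m * (M n * q)            ≡⟨ sym (*-assoc (M m) (M n) q) ⟩
    M m * M n * q              ∎

M-*-new-prime-divisor : ∀ {m n} → 1 < m → m < n → gcd m n ≡ 1 → m * n ≢ 6 →
  ∃ λ p → Prime p × p ∣ M (m * n) × ¬ p ∣ M m × ¬ p ∣ M n
M-*-new-prime-divisor {m} {n} 1<m m<n gcd≡1 mn≢6 = new-prime-divisor (M-*-cofactor m n gcd≡1)
  where
  instance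
    m≢0 : NonZero m
    m≢0 = ≢-nonZero (m<n⇒n≢0 1<m)
    n≢0 : NonZero n
    n≢0 = ≢-nonZero (m<n⇒n≢0 m<n)
    mn≢0 : NonZero (m * n)
    mn≢0 = m*n≢0 m n
  new-prime-divisor : (∃ λ q → M (m * n) ≡ M m * M n * q × q ∣ geomSum (1 + M m) n × q ∣ geomSum (1 + M n) m) →
    ∃ λ p → Prime p × p ∣ M (m * n) × ¬ p ∣ M m × ¬ p ∣ M n
  new-prime-divisor (q , N≡abq , q∣A , q∣B)
    with ∣geomSum-∣geomSum⇒new-prime⊎∣* {k = n} {l = m} (M-odd m) (M-odd n) q∣A q∣B
  ... | inj₁ (p , p-prime , p∣q , p∤Mm , p∤Mn) =
    p , p-prime , ∣-trans p∣q (divides (M m * M n) N≡abq) , p∤Mm , p∤Mn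
  ... | inj₂ q∣nm = ⊥-elim (<⇒≱ (M*M*[m*n]<M[m*n] 1<m m<n gcd≡1 mn≢6) (begin
    M (m * n)            ≡⟨ N≡abq ⟩
    M m * M n * q        ≤⟨ *-monoʳ-≤ (M m * M n) (∣⇒≤ (subst (q ∣_) (*-comm n m) q∣nm)) ⟩
    M m * M n * (m * n)  ∎))
    where open ≤-Reasoning

module _ {a ℓ} {A : Set a} {P Q R : Pred A ℓ} (P? : Decidable P) (Q? : Decidable Q) (R? : Decidable R)
         (P⇒R : ∀ {x} → P x → R x) (Q⇒R : ∀ {x} → Q x → R x) (P∩Q⇒⊥ : ∀ {x} → P x → Q x → ⊥) where

  private
    #P #Q #R : List A → ℕ
    #P xs = length (filter P? xs)
    #Q xs = length (filter Q? xs)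
    #R xs = length (filter R? xs)

    preserved-by-∷ : ∀ x xs k → k + (#P xs + #Q xs) ≤ #R xs → k + (#P (x ∷ xs) + #Q (x ∷ xs)) ≤ #R (x ∷ xs)
    preserved-by-∷ x xs k h with P? x | Q? x | R? x
    ... | yes px | yes qx | _     = ⊥-elim (P∩Q⇒⊥ px qx)
    ... | yes px | no _   | no ¬r = ⊥-elim (¬r (P⇒R px))
    ... | no _   | yes qx | no ¬r = ⊥-elim (¬r (Q⇒R qx))
    ... | yes _  | no _   | yes _ = ≤-trans (≤-reflexive (+-suc k _)) (s≤s h)
    ... | no _   | yes _  | yes _ =
      ≤-trans (≤-reflexive (trans (cong (k +_) (+-suc (#P xs) (#Q xs))) (+-suc k _))) (s≤s h)
    ... | no _   | no _   | yes _ = m≤n⇒m≤1+n h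
    ... | no _   | no _   | no _  = h

  length-filter-disjoint-≤ : ∀ xs → length (filter P? xs) + length (filter Q? xs) ≤ length (filter R? xs)
  length-filter-disjoint-≤ []       = z≤n
  length-filter-disjoint-≤ (x ∷ xs) = preserved-by-∷ x xs 0 (length-filter-disjoint-≤ xs)

  length-filter-disjoint-< : ∀ {x xs} → x ∈ xs → R x → ¬ P x → ¬ Q x →
    length (filter P? xs) + length (filter Q? xs) < length (filter R? xs)
  length-filter-disjoint-< {x} {_ ∷ xs} (here refl) r ¬p ¬q with P? x | Q? x | R? x
  ... | yes p | _     | _     = ⊥-elim (¬p p)
  ... | no _  | yes q | _     = ⊥-elim (¬q q)
  ... | no _  | no _  | no ¬r = ⊥-elim (¬r r)
  ... | no _  | no _  | yes _ = s≤s (length-filter-disjoint-≤ xs)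
  length-filter-disjoint-< {xs = y ∷ xs} (there x∈xs) r ¬p ¬q =
    preserved-by-∷ y xs 1 (length-filter-disjoint-< x∈xs r ¬p ¬q)

length-filter-upTo-mono : ∀ {ℓ} {P : Pred ℕ ℓ} (P? : Decidable P) {m n} → m ≤ n →
  length (filter P? (upTo m)) ≤ length (filter P? (upTo n))
length-filter-upTo-mono P? m≤n = go (≤⇒≤′ m≤n)
  where
  go : ∀ {m n} → m ≤′ n → length (filter P? (upTo m)) ≤ length (filter P? (upTo n))
  go ≤′-refl            = ≤-refl
  go {m} (≤′-step {n} m≤′n) = begin
    length (filter P? (upTo m))                             ≤⟨ go m≤′n ⟩
    length (filter P? (upTo n))                             ≤⟨ m≤m+n _ _ ⟩
    length (filter P? (upTo n)) + length (filter P? [ n ])  ≡⟨ sym (length-++ (filter P? (upTo n))) ⟩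
    length (filter P? (upTo n) ++ filter P? [ n ])          ≡⟨ cong length (sym (filter-++ P? (upTo n) [ n ])) ⟩
    length (filter P? (upTo n ∷ʳ n))                        ≡⟨ cong (length ∘ filter P?) (upTo-∷ʳ n) ⟩
    length (filter P? (upTo (suc n)))                       ∎
    where open ≤-Reasoning

prime-divisor? : ∀ n → Decidable (λ p → Prime p × p ∣ n)
prime-divisor? n p = prime? p ×-dec p ∣? n

ω-≤-upTo : ∀ {n k} → n ≤ k → ω n ≤ length (filter (prime-divisor? n) (upTo (suc k)))
ω-≤-upTo {n} n≤k = length-filter-upTo-mono (prime-divisor? n) (s≤s n≤k)

ω-+-< : ∀ {a b n p} .{{_ : NonZero n}} → Coprime a b → a ∣ n → b ∣ n →
  Prime p → p ∣ n → ¬ p ∣ a → ¬ p ∣ b → ω a + ω b < ω n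
ω-+-< {a} {b} {n} a⊥b a∣n b∣n p-prime p∣n p∤a p∤b = begin-strict
  ω a + ω b
    ≤⟨ +-mono-≤ (ω-≤-upTo (∣⇒≤ a∣n)) (ω-≤-upTo (∣⇒≤ b∣n)) ⟩
  length (filter (prime-divisor? a) (upTo (suc n))) + length (filter (prime-divisor? b) (upTo (suc n)))
    <⟨ length-filter-disjoint-< (prime-divisor? a) (prime-divisor? b) (prime-divisor? n)
         (λ (q-prime , q∣a) → q-prime , ∣-trans q∣a a∣n) (λ (q-prime , q∣b) → q-prime , ∣-trans q∣b b∣n)
         (λ (q-prime , q∣a) (_ , q∣b) → ¬prime[1] (subst Prime (a⊥b (q∣a , q∣b)) q-prime))
         (∈-upTo⁺ (s≤s (∣⇒≤ p∣n))) (p-prime , p∣n) (p∤a ∘ proj₂) (p∤b ∘ proj₂) ⟩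
  ω n ∎
  where open ≤-Reasoning

proposition1 : (m n : ℕ) → 1 < m → m < n → gcd m n ≡ 1 → m * n ≢ 6 →
    ω (M m) + ω (M n) < ω (M (m * n))
proposition1 m n 1<m m<n gcd≡1 mn≢6 =
  let p , p-prime , p∣N , p∤Mm , p∤Mn = M-*-new-prime-divisor 1<m m<n gcd≡1 mn≢6
  in ω-+-< {{M-nonZero (m * n)}} (gcd≡1⇒M-coprime m n gcd≡1) (M-mono-∣ (m∣m*n {m} n)) (M-mono-∣ (n∣m*n m))
       p-prime p∣N p∤Mm p∤Mn
  where
  instance
    mn≢0 : NonZero (m * n)
    mn≢0 = m*n≢0 m n {{≢-nonZero (m<n⇒n≢0 1<m)}} {{≢-nonZero (m<n⇒n≢0 m<n)}}
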